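{- Let $p$ be an odd prime, $l\ge 1$ an integer, $q=p^l$, and let $E\subset \mathbb{Z}_q^2$ with $|E|>p^{2l-\frac{1}{2}}$. Then $|V_2(E)|\geq \frac{q}{4}\cdot\frac{1+p}{p}-1$.
   Context: $\mathbb{Z}_q$ denotes the ring of integers modulo $q$. For $E\subset\mathbb{Z}_q^2$, $V_2(E)=\{\det(x^{1}-x^{3},\,x^{2}-x^{3}) : x^1,x^2,x^3\in E\}\setminus\{0\}$, where $\det(u,v)$ is the determinant of the $2\times 2$ matrix with columns $u,v$, computed in $\mathbb{Z}_q$. -}

module Defs where

open import Data.Nat using (ℕ)
open import Data.Fin using (Fin; toℕ)
open import Data.Integer using (ℤ; +_; _-_; _*_)
open import Data.Integer.Divisibility using (_∣_)
open import Data.Product using (_×_; _,_; ∃-syntax)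
open import Data.List using (List)
open import Data.List.Membership.Propositional using (_∈_)
open import Relation.Binary.PropositionalEquality using (_≢_)

-- Elements of Z_q are represented by Fin q (residues 0 .. q-1);
-- points of Z_q^2 by pairs.
Point : ℕ → Set
Point q = Fin q × Fin q

⟦_⟧ : {q : ℕ} → Fin q → ℤ
⟦ a ⟧ = + toℕ a

detℤ : {q : ℕ} → Point q → Point q → Point q → ℤ
detℤ (a1 , b1) (a2 , b2) (a3 , b3) =
  ((⟦ a1 ⟧ - ⟦ a3 ⟧) * (⟦ b2 ⟧ - ⟦ b3 ⟧)) - ((⟦ a2 ⟧ - ⟦ a3 ⟧) * (⟦ b1 ⟧ - ⟦ b3 ⟧))

InV2 : (q : ℕ) → List (Point q) → Fin q → Set
InV2 q E d =
  (toℕ d ≢ 0) ×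
  (∃[ x1 ] ∃[ x2 ] ∃[ x3 ]
     ((x1 ∈ E) × (x2 ∈ E) × (x3 ∈ E) ×
      ((+ q) ∣ (detℤ x1 x2 x3 - ⟦ d ⟧))))

module Submission where

-- For a slope t let k_t be the number of lines y = tx + c meeting E and P_t the number
-- of ordered pairs of points of E on a common line of slope t; Cauchy–Schwarz over these lines
-- gives |E|² ≤ k_t P_t.  Split P_t = G_t + B_t according to whether the abscissae of the pair
-- differ by a unit or by a multiple of p.  A unit-step pair is aligned in only one direction, so
-- ∑_t G_t ≤ |E|²; a point pairs with at most q · q/p points by non-unit steps over all directions,
-- so p ∑_t B_t ≤ |E| q².  If no direction had both G_t > 0 and 4p k_t ≥ q(1 + p), averaging would
-- give (3p - 1)|E| ≤ 4q², impossible when |E|² > q⁴/p and p ≥ 3.  In a direction t carrying a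
-- unit-step pair (x₃, x₁) we have det(x₁ - x₃, x₂ - x₃) ≡ δ (c - I₃) for x₂ on the line of
-- intercept c, with δ a unit, so the k_t lines give k_t distinct determinants: k_t ≤ |V₂(E)| + 1.

open import Defs
open import Data.Nat using (ℕ; _^_; _*_; _+_; _∸_; _≤_; _<_; _%_)
open import Data.Nat.Primality using (Prime)
open import Data.Fin using (Fin; toℕ; fromℕ<)
open import Data.Fin.Properties using (toℕ<n; toℕ-injective; toℕ-fromℕ<)
open import Data.List using (List; []; _∷_; length)
open import Data.List.Relation.Unary.Any using (here; there)
open import Data.List.Relation.Unary.All as All using (All; []; _∷_)
open import Data.List.Relation.Unary.AllPairs using (_∷_)
open import Data.List.Membership.Propositional using (_∈_)
open import Data.List.Relation.Unary.Unique.Propositional using (Unique)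
open import Function.Bundles using (_⇔_; Equivalence)
open import Relation.Binary.PropositionalEquality using (_≡_)

open import Data.Nat using (zero; suc; z≤n; s≤s; NonZero; _≟_; _<?_; _≤?_; _⊔_; ≢-nonZero; nonTrivial⇒≢1; anyUpTo?)
open import Data.Nat.Properties
open import Data.Product using (∃; _×_; _,_; proj₁; proj₂)
open import Data.Sum using (inj₁; inj₂)
open import Data.Empty using (⊥; ⊥-elim)
open import Relation.Nullary using (Dec; yes; no; ¬_; ¬?)
open import Relation.Nullary.Decidable using (map′; _×-dec_)
open import Relation.Binary.PropositionalEquality using (refl; sym; trans; cong; cong₂; subst; subst₂; _≢_; module ≡-Reasoning)
import Data.Nat.Tactic.RingSolver as ℕ-Ring
open import Data.Nat.Primality using (euclidsLemma; prime⇒nonZero; prime⇒nonTrivial)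
import Data.Nat.Divisibility as ℕ-Div
open import Data.Integer as ℤ using (ℤ; +_; ∣_∣) renaming (_+_ to _+ℤ_; _-_ to _-ℤ_; _*_ to _*ℤ_)
import Data.Integer.Properties as ℤ-Prop
open import Data.Integer.Divisibility.Signed using (_∣_; divides; _∣?_; ∣ᵤ⇒∣; ∣⇒∣ᵤ; ∣m∣n⇒∣m+n; ∣m∣n⇒∣m-n; ∣m⇒∣-m; ∣n⇒∣m*n)
open import Data.Integer.DivMod using (_%ℕ_; _/ℕ_; a≡a%ℕn+[a/ℕn]*n; n%ℕd<d)
import Data.Integer.Tactic.RingSolver as ℤ-Ring
open import Function using (_∘_)

𝟙 : {P : Set} → Dec P → ℕ
𝟙 (yes _) = 1
𝟙 (no _)  = 0

𝟙≤1 : {P : Set} (d : Dec P) → 𝟙 d ≤ 1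
𝟙≤1 (yes _) = s≤s z≤n
𝟙≤1 (no _)  = z≤n

𝟙-yes : {P : Set} (d : Dec P) → P → 𝟙 d ≡ 1
𝟙-yes (yes _) _ = refl
𝟙-yes (no ¬p) p = ⊥-elim (¬p p)

𝟙-pos : {P : Set} (d : Dec P) → 0 < 𝟙 d → P
𝟙-pos (yes p) _ = p

*-pos : ∀ x y → 0 < x * y → 0 < x × 0 < y
*-pos (suc x) (suc y) _ = s≤s z≤n , s≤s z≤n
*-pos (suc x) zero pos = ⊥-elim (<-irrefl refl (subst (0 <_) (*-zeroʳ x) pos))

∑ : ℕ → (ℕ → ℕ) → ℕ
∑ zero    f = 0
∑ (suc n) f = ∑ n f + f n

syntax ∑ n (λ i → e) = ∑[ i < n ] e

∑-cong : ∀ n {f g : ℕ → ℕ} → (∀ i → i < n → f i ≡ g i) → ∑ n f ≡ ∑ n g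
∑-cong zero    h = refl
∑-cong (suc n) h = cong₂ _+_ (∑-cong n (λ i i<n → h i (m≤n⇒m≤1+n i<n))) (h n ≤-refl)

∑-mono : ∀ n {f g : ℕ → ℕ} → (∀ i → i < n → f i ≤ g i) → ∑ n f ≤ ∑ n g
∑-mono zero    h = z≤n
∑-mono (suc n) h = +-mono-≤ (∑-mono n (λ i i<n → h i (m≤n⇒m≤1+n i<n))) (h n ≤-refl)

∑-distrib-+ : ∀ n (f g : ℕ → ℕ) → ∑[ i < n ] (f i + g i) ≡ ∑ n f + ∑ n g
∑-distrib-+ zero    f g = refl
∑-distrib-+ (suc n) f g =
  trans (cong (_+ (f n + g n)) (∑-distrib-+ n f g)) (+-+-interchange (∑ n f) (∑ n g) (f n) (g n))
  where
  +-+-interchange : ∀ a b c d → a + b + (c + d) ≡ a + c + (b + d)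
  +-+-interchange = ℕ-Ring.solve-∀

∑-distribˡ : ∀ n k (f : ℕ → ℕ) → k * ∑ n f ≡ ∑[ i < n ] (k * f i)
∑-distribˡ zero    k f = *-zeroʳ k
∑-distribˡ (suc n) k f = trans (*-distribˡ-+ k (∑ n f) (f n)) (cong (_+ k * f n) (∑-distribˡ n k f))

∑-distribʳ : ∀ n k (f : ℕ → ℕ) → ∑ n f * k ≡ ∑[ i < n ] (f i * k)
∑-distribʳ n k f = trans (*-comm (∑ n f) k) (trans (∑-distribˡ n k f) (∑-cong n (λ i _ → *-comm k (f i))))

∑-const : ∀ n k → ∑[ i < n ] k ≡ n * k
∑-const zero    k = refl
∑-const (suc n) k = trans (cong (_+ k) (∑-const n k)) (+-comm (n * k) k)

∑-zero : ∀ n {f : ℕ → ℕ} → (∀ i → i < n → f i ≡ 0) → ∑ n f ≡ 0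
∑-zero n h = trans (∑-cong n h) (trans (∑-const n 0) (*-zeroʳ n))

∑-comm : ∀ m n (f : ℕ → ℕ → ℕ) → ∑[ i < m ] ∑[ j < n ] f i j ≡ ∑[ j < n ] ∑[ i < m ] f i j
∑-comm zero    n f = sym (∑-zero n (λ _ _ → refl))
∑-comm (suc m) n f =
  trans (cong (_+ ∑[ j < n ] f m j) (∑-comm m n f))
        (sym (∑-distrib-+ n (λ j → ∑[ i < m ] f i j) (f m)))

∑-split : ∀ m n (f : ℕ → ℕ) → ∑ (m + n) f ≡ ∑ m f + ∑[ i < n ] f (m + i)
∑-split m zero    f = trans (cong (λ k → ∑ k f) (+-identityʳ m)) (sym (+-identityʳ _))
∑-split m (suc n) f = begin
  ∑ (m + suc n) f                           ≡⟨ cong (λ k → ∑ k f) (+-suc m n) ⟩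
  ∑ (m + n) f + f (m + n)                   ≡⟨ cong (_+ f (m + n)) (∑-split m n f) ⟩
  ∑ m f + ∑[ i < n ] f (m + i) + f (m + n)  ≡⟨ +-assoc (∑ m f) _ _ ⟩
  ∑ m f + (∑[ i < n ] f (m + i) + f (m + n)) ∎
  where open ≡-Reasoning

term≤∑ : ∀ n (f : ℕ → ℕ) v → v < n → f v ≤ ∑ n f
term≤∑ (suc n) f v v<1+n with v ≟ n
... | yes refl = m≤n+m (f n) (∑ n f)
... | no  v≢n  = ≤-trans (term≤∑ n f v (≤∧≢⇒< (≤-pred v<1+n) v≢n)) (m≤m+n (∑ n f) (f n))

∑-pos : ∀ n (f : ℕ → ℕ) → 0 < ∑ n f → ∃ λ i → i < n × 0 < f i
∑-pos (suc n) f pos with f n in fn≡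
... | suc _ = n , ≤-refl , subst (0 <_) (sym fn≡) (s≤s z≤n)
... | zero with ∑-pos n f (subst (0 <_) (+-identityʳ _) pos)
...   | i , i<n , fi>0 = i , m≤n⇒m≤1+n i<n , fi>0

∑-≤1 : ∀ n (f : ℕ → ℕ) → (∀ i → f i ≤ 1) →
       (∀ i j → i < n → j < n → 0 < f i → 0 < f j → i ≡ j) → ∑ n f ≤ 1
∑-≤1 zero    f f≤1 uniq = z≤n
∑-≤1 (suc n) f f≤1 uniq with f n in fn≡
... | zero  = subst (_≤ 1) (sym (+-identityʳ _))
                (∑-≤1 n f f≤1 (λ i j i<n j<n → uniq i j (m≤n⇒m≤1+n i<n) (m≤n⇒m≤1+n j<n)))
... | suc k = subst (λ s → s + suc k ≤ 1) (sym (∑-zero n others-vanish)) (subst (_≤ 1) fn≡ (f≤1 n))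
  where
  others-vanish : ∀ i → i < n → f i ≡ 0
  others-vanish i i<n with f i in fi≡
  ... | zero  = refl
  ... | suc _ = ⊥-elim (<-irrefl (uniq i n (m≤n⇒m≤1+n i<n) ≤-refl
                  (subst (0 <_) (sym fi≡) (s≤s z≤n)) (subst (0 <_) (sym fn≡) (s≤s z≤n))) i<n)

∑-≤-length : ∀ n (f : ℕ → ℕ) → (∀ i → f i ≤ 1) → ∑ n f ≤ n
∑-≤-length n f f≤1 = ≤-trans (∑-mono n (λ i _ → f≤1 i)) (≤-reflexive (trans (∑-const n 1) (*-identityʳ n)))

∑-point : ∀ n v → v < n → ∑[ i < n ] 𝟙 (v ≟ i) ≡ 1
∑-point n v v<n = ≤-antisym
  (∑-≤1 n _ (λ i → 𝟙≤1 (v ≟ i)) (λ i j _ _ pi pj → trans (sym (𝟙-pos (v ≟ i) pi)) (𝟙-pos (v ≟ j) pj)))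
  (subst (_≤ ∑[ i < n ] 𝟙 (v ≟ i)) (𝟙-yes (v ≟ v) refl) (term≤∑ n _ v v<n))

∑² : ℕ → (ℕ → ℕ → ℕ) → ℕ
∑² n F = ∑[ a < n ] ∑[ b < n ] F a b

syntax ∑² n (λ a b → e) = ∑²[ a , b < n ] e

∑²-cong : ∀ n {F G : ℕ → ℕ → ℕ} → (∀ a b → F a b ≡ G a b) → ∑² n F ≡ ∑² n G
∑²-cong n h = ∑-cong n (λ a _ → ∑-cong n (λ b _ → h a b))

∑²-mono : ∀ n {F G : ℕ → ℕ → ℕ} → (∀ a b → F a b ≤ G a b) → ∑² n F ≤ ∑² n G
∑²-mono n h = ∑-mono n (λ a _ → ∑-mono n (λ b _ → h a b))

∑²-distribˡ : ∀ n k F → k * ∑² n F ≡ ∑²[ a , b < n ] (k * F a b)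
∑²-distribˡ n k F = trans (∑-distribˡ n k _) (∑-cong n (λ a _ → ∑-distribˡ n k (F a)))

∑²-distribʳ : ∀ n k F → ∑² n F * k ≡ ∑²[ a , b < n ] (F a b * k)
∑²-distribʳ n k F = trans (∑-distribʳ n k _) (∑-cong n (λ a _ → ∑-distribʳ n k (F a)))

∑²-distrib-+ : ∀ n F G → ∑²[ a , b < n ] (F a b + G a b) ≡ ∑² n F + ∑² n G
∑²-distrib-+ n F G = trans (∑-cong n (λ a _ → ∑-distrib-+ n (F a) (G a))) (∑-distrib-+ n _ _)

∑-∑²-comm : ∀ m n (F : ℕ → ℕ → ℕ → ℕ) →
  ∑[ t < m ] ∑²[ a , b < n ] F t a b ≡ ∑²[ a , b < n ] ∑[ t < m ] F t a b
∑-∑²-comm m n F = trans (∑-comm m n (λ t a → ∑[ b < n ] F t a b))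
                        (∑-cong n (λ a _ → ∑-comm m n (λ t b → F t a b)))

∑²-pos : ∀ n F → 0 < ∑² n F → ∃ λ a → ∃ λ b → 0 < F a b
∑²-pos n F pos with ∑-pos n _ pos
... | a , _ , pos-a with ∑-pos n (F a) pos-a
...   | b , _ , pos-ab = a , b , pos-ab

∑²-product : ∀ n F G → ∑² n F * ∑² n G ≡ ∑²[ a , b < n ] ∑²[ a' , b' < n ] (F a b * G a' b')
∑²-product n F G = trans (∑²-distribʳ n (∑² n G) F) (∑²-cong n (λ a b → ∑²-distribˡ n (F a b) G))

2xy≤x²+y²-ordered : ∀ {x y} → x ≤ y → 2 * x * y ≤ x * x + y * y
2xy≤x²+y²-ordered {x} {y} x≤y =
  subst (λ z → 2 * x * z ≤ x * x + z * z) (m+[n∸m]≡n x≤y)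
        (subst (2 * x * (x + (y ∸ x)) ≤_) (square-gap x (y ∸ x)) (m≤m+n _ _))
  where
  square-gap : ∀ x d → 2 * x * (x + d) + d * d ≡ x * x + (x + d) * (x + d)
  square-gap = ℕ-Ring.solve-∀

2xy≤x²+y² : ∀ x y → 2 * x * y ≤ x * x + y * y
2xy≤x²+y² x y with ≤-total x y
... | inj₁ x≤y = 2xy≤x²+y²-ordered x≤y
... | inj₂ y≤x = subst₂ _≤_ (swap x y) (+-comm (y * y) (x * x)) (2xy≤x²+y²-ordered y≤x)
  where
  swap : ∀ x y → 2 * y * x ≡ 2 * x * y
  swap = ℕ-Ring.solve-∀

support : ℕ → (ℕ → ℕ) → ℕ
support n f = ∑[ i < n ] 𝟙 (0 <? f i)

-- Summing 2xy ≤ x² + y² over the support of f, for a fixed x.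
cauchy-schwarz-step : ∀ n f x → 2 * x * ∑ n f ≤ support n f * (x * x) + ∑[ i < n ] (f i * f i)
cauchy-schwarz-step zero    f x = ≤-reflexive (*-zeroʳ (2 * x))
cauchy-schwarz-step (suc n) f x with f n
... | zero  = subst₂ _≤_ (cong (2 * x *_) (sym (+-identityʳ (∑ n f))))
                         (cong₂ (λ k s → k * (x * x) + s) (sym (+-identityʳ (support n f)))
                                                           (sym (+-identityʳ (∑[ i < n ] (f i * f i)))))
                         (cauchy-schwarz-step n f x)
... | suc y = subst₂ _≤_ (sym (*-distribˡ-+ (2 * x) (∑ n f) (suc y)))
                         (sym (regroup (support n f) (x * x) (∑[ i < n ] (f i * f i)) (suc y * suc y)))
                         (+-mono-≤ (cauchy-schwarz-step n f x) (2xy≤x²+y² x (suc y)))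
  where
  regroup : ∀ k u s v → (k + 1) * u + (s + v) ≡ k * u + s + (u + v)
  regroup = ℕ-Ring.solve-∀

cauchy-schwarz : ∀ n f → ∑ n f * ∑ n f ≤ support n f * ∑[ i < n ] (f i * f i)
cauchy-schwarz zero    f = z≤n
cauchy-schwarz (suc n) f with f n
... | zero  = subst₂ _≤_ (cong₂ _*_ (sym (+-identityʳ (∑ n f))) (sym (+-identityʳ (∑ n f))))
                         (cong₂ _*_ (sym (+-identityʳ (support n f))) (sym (+-identityʳ (∑[ i < n ] (f i * f i)))))
                         (cauchy-schwarz n f)
... | suc y = subst₂ _≤_ (sym (expand (∑ n f) (suc y)))
                         (collect (support n f) (∑[ i < n ] (f i * f i)) (suc y * suc y))
                         (+-monoˡ-≤ (suc y * suc y)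
                           (+-mono-≤ (cauchy-schwarz n f) (cauchy-schwarz-step n f (suc y))))
  where
  expand : ∀ s y → (s + y) * (s + y) ≡ s * s + 2 * y * s + y * y
  expand = ℕ-Ring.solve-∀
  collect : ∀ k s v → k * s + (k * v + s) + v ≡ (k + 1) * (s + v)
  collect = ℕ-Ring.solve-∀

𝟙*𝟙-pos : {P Q : Set} (x : Dec P) (y : Dec Q) → 0 < 𝟙 x * 𝟙 y → P × Q
𝟙*𝟙-pos x y pos = 𝟙-pos x (proj₁ (*-pos (𝟙 x) (𝟙 y) pos)) , 𝟙-pos y (proj₂ (*-pos (𝟙 x) (𝟙 y) pos))

𝟙*𝟙≤1 : {P Q : Set} (x : Dec P) (y : Dec Q) → 𝟙 x * 𝟙 y ≤ 1
𝟙*𝟙≤1 x y = *-mono-≤ (𝟙≤1 x) (𝟙≤1 y)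

𝟙-split : {P Q : Set} (P? : Dec P) (Q? : Dec Q) → 𝟙 P? ≤ 𝟙 Q? + 𝟙 (P? ×-dec ¬? Q?)
𝟙-split (yes _) (yes _) = s≤s z≤n
𝟙-split (yes _) (no _)  = s≤s z≤n
𝟙-split (no _)  _       = z≤n

≤1⇒≤ : ∀ {s g} → s ≤ 1 → (0 < s → 1 ≤ g) → s ≤ g
≤1⇒≤ {zero}        _         _   = z≤n
≤1⇒≤ {suc zero}    _         pos = pos (s≤s z≤n)
≤1⇒≤ {suc (suc _)} (s≤s ()) _

count-by-injection : ∀ n m {P : ℕ → Set} (P? : ∀ c → Dec (P c)) (h g : ℕ → ℕ) →
  (∀ c → c < n → P c → h c < m) →
  (∀ c c' → c < n → c' < n → P c → P c' → h c ≡ h c' → c ≡ c') →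
  (∀ c → c < n → P c → 1 ≤ g (h c)) →
  ∑[ c < n ] 𝟙 (P? c) ≤ ∑ m g
count-by-injection n m P? h g h<m h-inj g≥1 = begin
  ∑[ c < n ] 𝟙 (P? c)                             ≤⟨ ∑-mono n spread ⟩
  ∑[ c < n ] ∑[ d < m ] (𝟙 (P? c) * 𝟙 (h c ≟ d))  ≡⟨ ∑-comm n m _ ⟩
  ∑[ d < m ] ∑[ c < n ] (𝟙 (P? c) * 𝟙 (h c ≟ d))  ≤⟨ ∑-mono m (λ d _ → fibre d) ⟩
  ∑ m g                                            ∎
  where
  open ≤-Reasoning
  -- every counted c contributes exactly once, at d = h c
  spread : ∀ c → c < n → 𝟙 (P? c) ≤ ∑[ d < m ] (𝟙 (P? c) * 𝟙 (h c ≟ d))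
  spread c c<n with P? c
  ... | no  _  = z≤n
  ... | yes pc = ≤-reflexive (sym (trans (∑-cong m (λ d _ → +-identityʳ _)) (∑-point m (h c) (h<m c c<n pc))))
  -- the fibre of h over d contains at most one counted c, and only if g d ≥ 1
  fibre : ∀ d → ∑[ c < n ] (𝟙 (P? c) * 𝟙 (h c ≟ d)) ≤ g d
  fibre d = ≤1⇒≤
    (∑-≤1 n _ (λ c → 𝟙*𝟙≤1 (P? c) (h c ≟ d)) λ i j i<n j<n pos-i pos-j →
      let (Pi , hi≡d) = 𝟙*𝟙-pos (P? i) (h i ≟ d) pos-i
          (Pj , hj≡d) = 𝟙*𝟙-pos (P? j) (h j ≟ d) pos-j
      in h-inj i j i<n j<n Pi Pj (trans hi≡d (sym hj≡d)))
    λ pos → let (c , c<n , pos-c) = ∑-pos n _ pos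
                (Pc , hc≡d) = 𝟙*𝟙-pos (P? c) (h c ≟ d) pos-c
            in subst (λ e → 1 ≤ g e) hc≡d (g≥1 c c<n Pc)

record _≡_[mod_] (x y : ℤ) (n : ℕ) : Set where
  constructor n∣x-y
  field difference : (+ n) ∣ (x -ℤ y)

infix 4 _≡_[mod_]

_≡?_[mod_] : ∀ x y n → Dec (x ≡ y [mod n ])
x ≡? y [mod n ] = map′ n∣x-y _≡_[mod_].difference ((+ n) ∣? (x -ℤ y))

mod-by : ∀ {n x y x' y'} → x -ℤ y ≡ x' -ℤ y' → x ≡ y [mod n ] → x' ≡ y' [mod n ]
mod-by {n} eq (n∣x-y d) = n∣x-y (subst (+ n ∣_) eq d)

mod-sym : ∀ {n x y} → x ≡ y [mod n ] → y ≡ x [mod n ]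
mod-sym {n} {x} {y} (n∣x-y d) = n∣x-y (subst (+ n ∣_) (negate-difference x y) (∣m⇒∣-m d))
  where
  negate-difference : ∀ x y → ℤ.- (x -ℤ y) ≡ y -ℤ x
  negate-difference = ℤ-Ring.solve-∀

mod-trans : ∀ {n x y z} → x ≡ y [mod n ] → y ≡ z [mod n ] → x ≡ z [mod n ]
mod-trans {n} {x} {y} {z} (n∣x-y d) (n∣x-y e) = n∣x-y (subst (+ n ∣_) (telescope x y z) (∣m∣n⇒∣m+n d e))
  where
  telescope : ∀ x y z → (x -ℤ y) +ℤ (y -ℤ z) ≡ x -ℤ z
  telescope = ℤ-Ring.solve-∀

mod-*ˡ : ∀ {n x y} k → x ≡ y [mod n ] → k *ℤ x ≡ k *ℤ y [mod n ]
mod-*ˡ {n} {x} {y} k (n∣x-y d) = n∣x-y (subst (+ n ∣_) (factor k x y) (∣n⇒∣m*n k d))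
  where
  factor : ∀ k x y → k *ℤ (x -ℤ y) ≡ k *ℤ x -ℤ k *ℤ y
  factor = ℤ-Ring.solve-∀

mod-sub : ∀ {n x y x' y'} → x ≡ y [mod n ] → x' ≡ y' [mod n ] → x -ℤ x' ≡ y -ℤ y' [mod n ]
mod-sub {n} {x} {y} {x'} {y'} (n∣x-y d) (n∣x-y e) = n∣x-y (subst (+ n ∣_) (regroup x y x' y') (∣m∣n⇒∣m-n d e))
  where
  regroup : ∀ x y x' y' → (x -ℤ y) -ℤ (x' -ℤ y') ≡ (x -ℤ x') -ℤ (y -ℤ y')
  regroup = ℤ-Ring.solve-∀

residue-unique : ∀ {n c c'} → c < n → c' < n → + c ≡ + c' [mod n ] → c ≡ c'
residue-unique {n} {c} {c'} c<n c'<n (n∣x-y n∣c-c') with ∣ + c -ℤ + c' ∣ in ∣c-c'∣≡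
... | zero  = ℤ-Prop.+-injective (ℤ-Prop.i-j≡0⇒i≡j (+ c) (+ c') (ℤ-Prop.∣i∣≡0⇒i≡0 ∣c-c'∣≡))
... | suc k = ⊥-elim (<-irrefl refl (≤-trans (s≤s n≤∣c-c'∣) (≤-trans ∣c-c'∣<max (⊔-lub c<n c'<n))))
  where
  n≤∣c-c'∣ : n ≤ suc k
  n≤∣c-c'∣ = ℕ-Div.∣⇒≤ (subst (n ℕ-Div.∣_) ∣c-c'∣≡ (∣⇒∣ᵤ n∣c-c'))
  ∣c-c'∣<max : suc (suc k) ≤ suc (c ⊔ c')
  ∣c-c'∣<max = s≤s (subst (_≤ c ⊔ c') (trans (sym (cong ∣_∣ (ℤ-Prop.m-n≡m⊖n c c'))) ∣c-c'∣≡)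
                                     (ℤ-Prop.∣m⊝n∣≤m⊔n c c'))

mod-reduce : ∀ z n .{{_ : NonZero n}} → z ≡ + (z %ℕ n) [mod n ]
mod-reduce z n = n∣x-y (divides (z /ℕ n)
  (trans (cong (_-ℤ + (z %ℕ n)) (a≡a%ℕn+[a/ℕn]*n z n)) (cancel (+ (z %ℕ n)) (z /ℕ n) (+ n))))
  where
  cancel : ∀ r a b → r +ℤ a *ℤ b -ℤ r ≡ a *ℤ b
  cancel = ℤ-Ring.solve-∀

%ℕ-equal⇒mod : ∀ z w n .{{_ : NonZero n}} → z %ℕ n ≡ w %ℕ n → z ≡ w [mod n ]
%ℕ-equal⇒mod z w n z%n≡w%n =
  mod-trans (mod-reduce z n) (subst (λ r → + r ≡ w [mod n ]) (sym z%n≡w%n) (mod-sym (mod-reduce w n)))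

prime-power-divisor : ∀ {p} l {a b} → Prime p → ¬ (p ℕ-Div.∣ a) → (p ^ l) ℕ-Div.∣ (a * b) → (p ^ l) ℕ-Div.∣ b
prime-power-divisor zero _ _ _ = ℕ-Div.1∣ _
prime-power-divisor {p} (suc l) {a} {b} pr p∤a p^l+1∣ab
  with euclidsLemma a b pr (ℕ-Div.m*n∣⇒m∣ p (p ^ l) p^l+1∣ab)
... | inj₁ p∣a = ⊥-elim (p∤a p∣a)
... | inj₂ (ℕ-Div.divides k refl) =
  subst ((p ^ suc l) ℕ-Div.∣_) (*-comm p k) (ℕ-Div.*-monoʳ-∣ p (prime-power-divisor l pr p∤a p^l∣ak))
  where
  instance _ = prime⇒nonZero pr
  regroup : ∀ a k p → a * (k * p) ≡ p * (a * k)
  regroup = ℕ-Ring.solve-∀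
  p^l∣ak : (p ^ l) ℕ-Div.∣ (a * k)
  p^l∣ak = ℕ-Div.*-cancelˡ-∣ p (subst (p * p ^ l ℕ-Div.∣_) (regroup a k p) p^l+1∣ab)

unit-cancel : ∀ {p} l {δ x y} → Prime p → ¬ (+ p ∣ δ) → δ *ℤ x ≡ δ *ℤ y [mod p ^ l ] → x ≡ y [mod p ^ l ]
unit-cancel {p} l {δ} {x} {y} pr p∤δ (n∣x-y d) = n∣x-y (∣ᵤ⇒∣ (prime-power-divisor l pr (p∤δ ∘ ∣ᵤ⇒∣)
  (subst (p ^ l ℕ-Div.∣_) (ℤ-Prop.abs-* δ (x -ℤ y)) (∣⇒∣ᵤ (subst (+ (p ^ l) ∣_) (factor δ x y) d)))))
  where
  factor : ∀ δ x y → δ *ℤ x -ℤ δ *ℤ y ≡ δ *ℤ (x -ℤ y)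
  factor = ℤ-Ring.solve-∀

multiples-in-range : ∀ p s (z : ℤ) → ∑[ i < p * s ] 𝟙 (+ p ∣? (+ i +ℤ z)) ≤ s
multiples-in-range p zero    z = ≤-reflexive (cong (λ m → ∑[ i < m ] 𝟙 (+ p ∣? (+ i +ℤ z))) (*-zeroʳ p))
multiples-in-range p (suc s) z = begin
  ∑ (p * suc s) multiple                         ≡⟨ cong (λ m → ∑ m multiple) (*-suc p s) ⟩
  ∑ (p + p * s) multiple                         ≡⟨ ∑-split p (p * s) multiple ⟩
  ∑ p multiple + ∑[ i < p * s ] multiple (p + i)
    ≡⟨ cong (λ rest → ∑ p multiple + rest) (∑-cong (p * s) (λ i _ → cong (𝟙 ∘ (+ p ∣?_)) (shift i))) ⟩
  ∑ p multiple + ∑[ i < p * s ] 𝟙 (+ p ∣? (+ i +ℤ (+ p +ℤ z)))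
                                                 ≤⟨ +-mono-≤ first-block (multiples-in-range p s (+ p +ℤ z)) ⟩
  suc s                                          ∎
  where
  open ≤-Reasoning
  multiple : ℕ → ℕ
  multiple i = 𝟙 (+ p ∣? (+ i +ℤ z))
  shift : ∀ i → + (p + i) +ℤ z ≡ + i +ℤ (+ p +ℤ z)
  shift i = trans (cong (_+ℤ z) (ℤ-Prop.pos-+ p i)) (exchange (+ p) (+ i) z)
    where
    exchange : ∀ x y z → x +ℤ y +ℤ z ≡ y +ℤ (x +ℤ z)
    exchange = ℤ-Ring.solve-∀
  -- two multiples i, j < p of p (after shifting by z) are congruent, hence equal
  first-block : ∑ p multiple ≤ 1
  first-block = ∑-≤1 p multiple (λ i → 𝟙≤1 (+ p ∣? _)) λ i j i<p j<p pos-i pos-j →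
    residue-unique i<p j<p (mod-by {x = + i +ℤ z} {y = + j +ℤ z} (cancel (+ i) (+ j) z)
      (n∣x-y (∣m∣n⇒∣m-n (𝟙-pos (+ p ∣? _) pos-i) (𝟙-pos (+ p ∣? _) pos-j))))
    where
    cancel : ∀ i j z → (i +ℤ z) -ℤ (j +ℤ z) ≡ i -ℤ j
    cancel = ℤ-Ring.solve-∀

module _ {q : ℕ} where

  mult : List (Point q) → ℕ → ℕ → ℕ
  mult []             a b = 0
  mult ((x , y) ∷ E) a b = 𝟙 (toℕ x ≟ a) * 𝟙 (toℕ y ≟ b) + mult E a b

  _at_,_ : Point q → ℕ → ℕ → Set
  (x , y) at a , b = toℕ x ≡ a × toℕ y ≡ b

  ∑²-mult : ∀ E → ∑² q (mult E) ≡ length E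
  ∑²-mult [] = ∑-zero q (λ a _ → ∑-zero q (λ _ _ → refl))
  ∑²-mult ((x , y) ∷ E) = trans (∑²-distrib-+ q _ (mult E)) (cong₂ _+_ point-mass (∑²-mult E))
    where
    point-mass : ∑²[ a , b < q ] (𝟙 (toℕ x ≟ a) * 𝟙 (toℕ y ≟ b)) ≡ 1
    point-mass = begin
      ∑²[ a , b < q ] (𝟙 (toℕ x ≟ a) * 𝟙 (toℕ y ≟ b))
        ≡⟨ ∑-cong q (λ a _ → sym (∑-distribˡ q (𝟙 (toℕ x ≟ a)) (λ b → 𝟙 (toℕ y ≟ b)))) ⟩
      ∑[ a < q ] (𝟙 (toℕ x ≟ a) * ∑[ b < q ] 𝟙 (toℕ y ≟ b))
        ≡⟨ ∑-cong q (λ a _ → cong (𝟙 (toℕ x ≟ a) *_) (∑-point q (toℕ y) (toℕ<n y))) ⟩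
      ∑[ a < q ] (𝟙 (toℕ x ≟ a) * 1)                       ≡⟨ ∑-cong q (λ a _ → *-identityʳ _) ⟩
      ∑[ a < q ] 𝟙 (toℕ x ≟ a)                             ≡⟨ ∑-point q (toℕ x) (toℕ<n x) ⟩
      1                                                    ∎
      where open ≡-Reasoning

  mult-absent : ∀ E a b → All (λ z → ¬ z at a , b) E → mult E a b ≡ 0
  mult-absent []             a b []         = refl
  mult-absent ((x , y) ∷ E) a b (¬at ∷ ¬ats) with toℕ x ≟ a | toℕ y ≟ b
  ... | yes x≡a | yes y≡b = ⊥-elim (¬at (x≡a , y≡b))
  ... | yes _   | no _    = mult-absent E a b ¬ats
  ... | no _    | _       = mult-absent E a b ¬ats

  mult≤1 : ∀ E → Unique E → ∀ a b → mult E a b ≤ 1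
  mult≤1 []             _            a b = z≤n
  mult≤1 ((x , y) ∷ E) (x∉E ∷ uniq) a b with toℕ x ≟ a | toℕ y ≟ b
  ... | yes refl | yes refl = ≤-reflexive (cong suc (mult-absent E _ _ (All.map other x∉E)))
    where
    other : ∀ {z} → (x , y) ≢ z → ¬ z at toℕ x , toℕ y
    other {x' , y'} ≢z (x'≡ , y'≡) = ≢z (cong₂ _,_ (toℕ-injective (sym x'≡)) (toℕ-injective (sym y'≡)))
  ... | yes _ | no _ = mult≤1 E uniq a b
  ... | no _  | _    = mult≤1 E uniq a b

  mult-pos : ∀ E a b → 0 < mult E a b → ∃ λ z → z ∈ E × z at a , b
  mult-pos ((x , y) ∷ E) a b pos with toℕ x ≟ a | toℕ y ≟ b
  ... | yes x≡a | yes y≡b = (x , y) , here refl , x≡a , y≡b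
  ... | yes _   | no _    = let (z , z∈E , at) = mult-pos E a b pos in z , there z∈E , at
  ... | no _    | _       = let (z , z∈E , at) = mult-pos E a b pos in z , there z∈E , at

  occ : List (Fin q) → ℕ → ℕ
  occ []      d = 0
  occ (x ∷ V) d = 𝟙 (toℕ x ≟ d) + occ V d

  ∑-occ : ∀ V → ∑ q (occ V) ≡ length V
  ∑-occ []      = ∑-zero q (λ _ _ → refl)
  ∑-occ (x ∷ V) = trans (∑-distrib-+ q _ _) (cong₂ _+_ (∑-point q (toℕ x) (toℕ<n x)) (∑-occ V))

  occ-∈ : ∀ V d → d ∈ V → 1 ≤ occ V (toℕ d)
  occ-∈ (x ∷ V) d (here refl) = subst (λ k → 1 ≤ k + occ V (toℕ x)) (sym (𝟙-yes (toℕ x ≟ toℕ x) refl)) (s≤s z≤n)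
  occ-∈ (x ∷ V) d (there d∈V) = ≤-trans (occ-∈ V d d∈V) (m≤n+m _ _)

module Lines (q : ℕ) .{{_ : NonZero q}} where

  intercept : ℕ → ℕ → ℕ → ℤ
  intercept t a b = + b -ℤ + t *ℤ + a

  OnLine : ℕ → ℕ → ℕ → ℕ → Set
  OnLine t c a b = intercept t a b ≡ + c [mod q ]

  Aligned : ℕ → ℕ → ℕ → ℕ → ℕ → Set
  Aligned t a b a' b' = intercept t a b ≡ intercept t a' b' [mod q ]

  on : ℕ → ℕ → ℕ → ℕ → ℕ
  on t c a b = 𝟙 (intercept t a b ≡? + c [mod q ])

  aligned : ℕ → ℕ → ℕ → ℕ → ℕ → ℕ
  aligned t a b a' b' = 𝟙 (intercept t a b ≡? intercept t a' b' [mod q ])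

  on-line-unique : ∀ t a b {c c'} → c < q → c' < q → OnLine t c a b → OnLine t c' a b → c ≡ c'
  on-line-unique t a b c<q c'<q on-c on-c' = residue-unique c<q c'<q (mod-trans (mod-sym on-c) on-c')

  lines-through-point : ∀ t a b → 1 ≤ ∑[ c < q ] on t c a b
  lines-through-point t a b =
    subst (_≤ ∑[ c < q ] on t c a b) (𝟙-yes (_ ≡? _ [mod q ]) (mod-reduce (intercept t a b) q))
          (term≤∑ q (λ c → on t c a b) _ (n%ℕd<d (intercept t a b) q))

  common-lines : ∀ t a b a' b' → ∑[ c < q ] (on t c a b * on t c a' b') ≤ aligned t a b a' b'
  common-lines t a b a' b' = ≤1⇒≤
    (∑-≤1 q _ (λ c → 𝟙*𝟙≤1 (_ ≡? _ [mod q ]) (_ ≡? _ [mod q ])) λ c c' c<q c'<q pos pos' →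
      on-line-unique t a b c<q c'<q (proj₁ (both c pos)) (proj₁ (both c' pos')))
    λ pos → let (c , _ , pos-c) = ∑-pos q _ pos
                (on-c , on-c') = both c pos-c
            in ≤-reflexive (sym (𝟙-yes (_ ≡? _ [mod q ]) (mod-trans on-c (mod-sym on-c'))))
    where
    both : ∀ c → 0 < on t c a b * on t c a' b' → OnLine t c a b × OnLine t c a' b'
    both c = 𝟙*𝟙-pos (_ ≡? _ [mod q ]) (_ ≡? _ [mod q ])

  module Incidences (E : List (Point q)) where

    points-on : ℕ → ℕ → ℕ
    points-on t c = ∑²[ a , b < q ] (mult E a b * on t c a b)

    lines-meeting : ℕ → ℕ
    lines-meeting t = support q (points-on t)

    aligned-pairs : ℕ → (ℕ → ℕ → ℕ) → ℕ
    aligned-pairs t w =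
      ∑²[ a , b < q ] ∑²[ a' , b' < q ] (mult E a b * mult E a' b' * (aligned t a b a' b' * w a a'))

    |E|≤∑points-on : ∀ t → length E ≤ ∑[ c < q ] points-on t c
    |E|≤∑points-on t = begin
      length E                                                ≡⟨ sym (∑²-mult E) ⟩
      ∑²[ a , b < q ] mult E a b                               ≡⟨ ∑²-cong q (λ a b → sym (*-identityʳ (mult E a b))) ⟩
      ∑²[ a , b < q ] (mult E a b * 1)                         ≤⟨ ∑²-mono q (λ a b → *-monoʳ-≤ (mult E a b) (lines-through-point t a b)) ⟩
      ∑²[ a , b < q ] (mult E a b * ∑[ c < q ] on t c a b)     ≡⟨ ∑²-cong q (λ a b → ∑-distribˡ q (mult E a b) (λ c → on t c a b)) ⟩
      ∑²[ a , b < q ] ∑[ c < q ] (mult E a b * on t c a b)     ≡⟨ sym (∑-∑²-comm q q (λ c a b → mult E a b * on t c a b)) ⟩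
      ∑[ c < q ] points-on t c                                 ∎
      where open ≤-Reasoning

    ∑points-on²≤aligned-pairs : ∀ t → ∑[ c < q ] (points-on t c * points-on t c) ≤ aligned-pairs t (λ _ _ → 1)
    ∑points-on²≤aligned-pairs t = begin
      ∑[ c < q ] (points-on t c * points-on t c)
        ≡⟨ ∑-cong q (λ c _ → ∑²-product q _ _) ⟩
      ∑[ c < q ] ∑²[ a , b < q ] ∑²[ a' , b' < q ] F c a b a' b'
        ≡⟨ ∑-∑²-comm q q (λ c a b → ∑²[ a' , b' < q ] F c a b a' b') ⟩
      ∑²[ a , b < q ] ∑[ c < q ] ∑²[ a' , b' < q ] F c a b a' b'
        ≡⟨ ∑²-cong q (λ a b → ∑-∑²-comm q q (λ c a' b' → F c a b a' b')) ⟩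
      ∑²[ a , b < q ] ∑²[ a' , b' < q ] ∑[ c < q ] F c a b a' b'
        ≤⟨ ∑²-mono q (λ a b → ∑²-mono q (λ a' b' → pair a b a' b')) ⟩
      aligned-pairs t (λ _ _ → 1)
        ∎
      where
      open ≤-Reasoning
      F : ℕ → ℕ → ℕ → ℕ → ℕ → ℕ
      F c a b a' b' = mult E a b * on t c a b * (mult E a' b' * on t c a' b')
      regroup : ∀ x y z w → x * y * (z * w) ≡ x * z * (y * w)
      regroup = ℕ-Ring.solve-∀
      pair : ∀ a b a' b' → ∑[ c < q ] F c a b a' b' ≤ mult E a b * mult E a' b' * (aligned t a b a' b' * 1)
      pair a b a' b' = begin
        ∑[ c < q ] F c a b a' b'
          ≡⟨ ∑-cong q (λ c _ → regroup (mult E a b) (on t c a b) (mult E a' b') (on t c a' b')) ⟩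
        ∑[ c < q ] (mult E a b * mult E a' b' * (on t c a b * on t c a' b'))
          ≡⟨ sym (∑-distribˡ q (mult E a b * mult E a' b') _) ⟩
        mult E a b * mult E a' b' * ∑[ c < q ] (on t c a b * on t c a' b')
          ≤⟨ *-monoʳ-≤ (mult E a b * mult E a' b') (common-lines t a b a' b') ⟩
        mult E a b * mult E a' b' * aligned t a b a' b'
          ≡⟨ cong (mult E a b * mult E a' b' *_) (sym (*-identityʳ _)) ⟩
        mult E a b * mult E a' b' * (aligned t a b a' b' * 1)
          ∎

    -- Cauchy–Schwarz over the lines of slope t:  |E|² ≤ #(lines meeting E) · #(aligned pairs).
    incidence-bound : ∀ t → length E * length E ≤ lines-meeting t * aligned-pairs t (λ _ _ → 1)
    incidence-bound t = begin
      length E * length E                                                 ≤⟨ *-mono-≤ (|E|≤∑points-on t) (|E|≤∑points-on t) ⟩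
      ∑ q (points-on t) * ∑ q (points-on t)                               ≤⟨ cauchy-schwarz q (points-on t) ⟩
      lines-meeting t * ∑[ c < q ] (points-on t c * points-on t c)        ≤⟨ *-monoʳ-≤ (lines-meeting t) (∑points-on²≤aligned-pairs t) ⟩
      lines-meeting t * aligned-pairs t (λ _ _ → 1)                       ∎
      where open ≤-Reasoning

    aligned-pairs-split : ∀ t (w₁ w₂ : ℕ → ℕ → ℕ) → (∀ a a' → w₁ a a' + w₂ a a' ≡ 1) →
      aligned-pairs t (λ _ _ → 1) ≡ aligned-pairs t w₁ + aligned-pairs t w₂
    aligned-pairs-split t w₁ w₂ w₁+w₂≡1 = trans
      (∑²-cong q (λ a b → trans (∑²-cong q (λ a' b' → split a b a' b')) (∑²-distrib-+ q _ _)))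
      (∑²-distrib-+ q _ _)
      where
      distrib : ∀ m x u v → m * (x * (u + v)) ≡ m * (x * u) + m * (x * v)
      distrib = ℕ-Ring.solve-∀
      split : ∀ a b a' b' → mult E a b * mult E a' b' * (aligned t a b a' b' * 1)
        ≡ mult E a b * mult E a' b' * (aligned t a b a' b' * w₁ a a') + mult E a b * mult E a' b' * (aligned t a b a' b' * w₂ a a')
      split a b a' b' = trans (cong (λ u → mult E a b * mult E a' b' * (aligned t a b a' b' * u)) (sym (w₁+w₂≡1 a a')))
                              (distrib (mult E a b * mult E a' b') (aligned t a b a' b') (w₁ a a') (w₂ a a'))

-- One direction t for which q(1 + p) ≤ 4p · #lines fails (or which has no unit pair):
-- the incidence bound N² ≤ k (G + B) then yields 4p N² ≤ 4pq B + q(1 + p) G.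
direction-bound : ∀ p q N k G B → 1 ≤ p → k ≤ q → N * N ≤ k * (G + B) →
                  ¬ (0 < G × q * (1 + p) ≤ 4 * p * k) → 4 * p * (N * N) ≤ 4 * p * q * B + q * (1 + p) * G
direction-bound p q N k zero B _ k≤q N²≤kB _ = begin
  4 * p * (N * N)                      ≤⟨ *-monoʳ-≤ (4 * p) (≤-trans N²≤kB (*-monoˡ-≤ B k≤q)) ⟩
  4 * p * (q * B)                      ≡⟨ sym (*-assoc (4 * p) q B) ⟩
  4 * p * q * B                        ≤⟨ m≤m+n _ _ ⟩
  4 * p * q * B + q * (1 + p) * 0      ∎
  where open ≤-Reasoning
direction-bound p q N k G@(suc _) B p≥1 _ N²≤k[G+B] not-rich with q * (1 + p) ≤? 4 * p * k
... | yes rich = ⊥-elim (not-rich (s≤s z≤n , rich))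
... | no  poor = begin
  4 * p * (N * N)                           ≤⟨ *-monoʳ-≤ (4 * p) N²≤k[G+B] ⟩
  4 * p * (k * (G + B))                     ≡⟨ sym (*-assoc (4 * p) k _) ⟩
  4 * p * k * (G + B)                       ≤⟨ *-monoˡ-≤ (G + B) (<⇒≤ (≰⇒> poor)) ⟩
  q * (1 + p) * (G + B)                     ≡⟨ distrib q p G B ⟩
  q * (1 + p) * B + q * (1 + p) * G         ≤⟨ +-monoˡ-≤ _ (*-monoˡ-≤ B 1+p≤4p) ⟩
  4 * p * q * B + q * (1 + p) * G           ∎
  where
  open ≤-Reasoning
  distrib : ∀ q p G B → q * (1 + p) * (G + B) ≡ q * (1 + p) * B + q * (1 + p) * G
  distrib = ℕ-Ring.solve-∀
  1+p≤4p : q * (1 + p) ≤ 4 * p * q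
  1+p≤4p = subst (q * (1 + p) ≤_) (*-comm q (4 * p))
             (*-monoʳ-≤ q (≤-trans (+-monoˡ-≤ p p≥1) (+-monoʳ-≤ p (m≤m+n p (p + (p + 0))))))

-- Averaging the direction bounds over all q directions and inserting the pair counts
-- ∑ G ≤ N² and p ∑ B ≤ N q² gives  4p N² ≤ 4N q² + (1 + p) N².
averaged-bound : ∀ p q N (G B : ℕ → ℕ) → .{{NonZero q}} →
  (∀ t → t < q → 4 * p * (N * N) ≤ 4 * p * q * B t + q * (1 + p) * G t) →
  ∑ q G ≤ N * N → p * ∑ q B ≤ N * (q * q) → 4 * p * (N * N) ≤ 4 * (N * (q * q)) + (1 + p) * (N * N)
averaged-bound p q N G B per-direction ∑G≤N² p∑B≤Nq² = *-cancelˡ-≤ q (begin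
  q * (4 * p * (N * N))                                   ≡⟨ sym (∑-const q _) ⟩
  ∑[ t < q ] (4 * p * (N * N))                            ≤⟨ ∑-mono q per-direction ⟩
  ∑[ t < q ] (4 * p * q * B t + q * (1 + p) * G t)        ≡⟨ ∑-distrib-+ q _ _ ⟩
  ∑[ t < q ] (4 * p * q * B t) + ∑[ t < q ] (q * (1 + p) * G t)
                                                          ≡⟨ sym (cong₂ _+_ (∑-distribˡ q (4 * p * q) B) (∑-distribˡ q (q * (1 + p)) G)) ⟩
  4 * p * q * ∑ q B + q * (1 + p) * ∑ q G                 ≡⟨ regroup p q (∑ q B) (∑ q G) ⟩
  4 * q * (p * ∑ q B) + q * (1 + p) * ∑ q G               ≤⟨ +-mono-≤ (*-monoʳ-≤ (4 * q) p∑B≤Nq²) (*-monoʳ-≤ (q * (1 + p)) ∑G≤N²) ⟩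
  4 * q * (N * (q * q)) + q * (1 + p) * (N * N)           ≡⟨ factor q N p ⟩
  q * (4 * (N * (q * q)) + (1 + p) * (N * N))             ∎)
  where
  open ≤-Reasoning
  regroup : ∀ p q b g → 4 * p * q * b + q * (1 + p) * g ≡ 4 * q * (p * b) + q * (1 + p) * g
  regroup = ℕ-Ring.solve-∀
  factor : ∀ q N p → 4 * q * (N * (q * q)) + q * (1 + p) * (N * N) ≡ q * (4 * (N * (q * q)) + (1 + p) * (N * N))
  factor = ℕ-Ring.solve-∀

-- For p ≥ 3 the averaged bound says (3p - 1) N ≤ 4q², i.e. N² ≤ 16 q⁴ / (3p - 1)² ≤ q⁴ / p,
-- contradicting q⁴ < p N².
few-points : ∀ p q N → 3 ≤ p → q * q * q * q < p * (N * N) →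
             4 * p * (N * N) ≤ 4 * (N * (q * q)) + (1 + p) * (N * N) → ⊥
few-points (suc zero)          _ _ (s≤s ())
few-points (suc (suc zero))    _ _ (s≤s (s≤s ()))
few-points p@(suc (suc (suc r))) q N _ q⁴<pN² averaged = <-irrefl refl (begin-strict
  16 * p * (N * N)                         ≤⟨ *-monoˡ-≤ (N * N) (16p≤[3p-1]² r) ⟩
  (8 + 3 * r) * (8 + 3 * r) * (N * N)      ≡⟨ square-product (8 + 3 * r) N ⟩
  ((8 + 3 * r) * N) * ((8 + 3 * r) * N)    ≤⟨ *-mono-≤ [3p-1]N≤4q² [3p-1]N≤4q² ⟩
  (4 * (q * q)) * (4 * (q * q))            ≡⟨ sixteen-q⁴ q ⟩
  16 * (q * q * q * q)                     <⟨ *-monoʳ-< 16 q⁴<pN² ⟩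
  16 * (p * (N * N))                       ≡⟨ sym (*-assoc 16 p (N * N)) ⟩
  16 * p * (N * N)                         ∎)
  where
  open ≤-Reasoning
  instance
    N≢0 : NonZero N
    N≢0 = ≢-nonZero λ { refl → n≮0 (subst (q * q * q * q <_) (*-zeroʳ p) q⁴<pN²) }
  split : ∀ r x → 4 * (3 + r) * x ≡ (8 + 3 * r) * x + (4 + r) * x
  split = ℕ-Ring.solve-∀
  [3p-1]N²≤4Nq² : (8 + 3 * r) * (N * N) ≤ 4 * (N * (q * q))
  [3p-1]N²≤4Nq² = +-cancelʳ-≤ ((4 + r) * (N * N)) _ _ (subst (_≤ 4 * (N * (q * q)) + (4 + r) * (N * N)) (split r (N * N)) averaged)
  pull-N : ∀ a N → a * (N * N) ≡ N * (a * N)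
  pull-N = ℕ-Ring.solve-∀
  pull-N′ : ∀ N b → 4 * (N * b) ≡ N * (4 * b)
  pull-N′ = ℕ-Ring.solve-∀
  [3p-1]N≤4q² : (8 + 3 * r) * N ≤ 4 * (q * q)
  [3p-1]N≤4q² = *-cancelˡ-≤ N (subst₂ _≤_ (pull-N (8 + 3 * r) N) (pull-N′ N (q * q)) [3p-1]N²≤4Nq²)
  16p≤[3p-1]² : ∀ r → 16 * (3 + r) ≤ (8 + 3 * r) * (8 + 3 * r)
  16p≤[3p-1]² r = subst (16 * (3 + r) ≤_) (sym (expand r)) (m≤m+n _ _)
    where
    expand : ∀ r → (8 + 3 * r) * (8 + 3 * r) ≡ 16 * (3 + r) + (16 + 32 * r + 9 * (r * r))
    expand = ℕ-Ring.solve-∀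
  square-product : ∀ a N → a * a * (N * N) ≡ (a * N) * (a * N)
  square-product = ℕ-Ring.solve-∀
  sixteen-q⁴ : ∀ q → (4 * (q * q)) * (4 * (q * q)) ≡ 16 * (q * q * q * q)
  sixteen-q⁴ = ℕ-Ring.solve-∀


module PrimePower (p l : ℕ) (pr : Prime p) where

  q : ℕ
  q = p ^ l

  instance
    q≢0 : NonZero q
    q≢0 = m^n≢0 p l {{prime⇒nonZero pr}}

  open Lines q public

  unit-step nonunit-step : ℕ → ℕ → ℕ
  unit-step    a a' = 𝟙 (¬? (+ p ∣? (+ a' -ℤ + a)))
  nonunit-step a a' = 𝟙 (+ p ∣? (+ a' -ℤ + a))

  steps-complementary : ∀ a a' → unit-step a a' + nonunit-step a a' ≡ 1
  steps-complementary a a' with + p ∣? (+ a' -ℤ + a)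
  ... | yes _ = refl
  ... | no  _ = refl

  slope-unique : ∀ {t t'} a b a' b' → t < q → t' < q → ¬ (+ p ∣ (+ a' -ℤ + a)) →
                 Aligned t a b a' b' → Aligned t' a b a' b' → t ≡ t'
  slope-unique {t} {t'} a b a' b' t<q t'<q unit al al' =
    residue-unique t<q t'<q (unit-cancel l pr unit (mod-by (difference-of-slopes (+ a) (+ b) (+ a') (+ b') (+ t) (+ t'))
                                                          (mod-sub al al')))
    where
    difference-of-slopes : ∀ a b a' b' t t' →
      (b -ℤ t *ℤ a -ℤ (b -ℤ t' *ℤ a)) -ℤ (b' -ℤ t *ℤ a' -ℤ (b' -ℤ t' *ℤ a')) ≡ (a' -ℤ a) *ℤ t -ℤ (a' -ℤ a) *ℤ t'
    difference-of-slopes = ℤ-Ring.solve-∀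

  slopes-of-unit-step : ∀ a b a' b' → ∑[ t < q ] (aligned t a b a' b' * unit-step a a') ≤ 1
  slopes-of-unit-step a b a' b' = ∑-≤1 q _ (λ t → 𝟙*𝟙≤1 (_ ≡? _ [mod q ]) (¬? (+ p ∣? _))) λ t t' t<q t'<q pos pos' →
    let (al  , unit) = 𝟙*𝟙-pos (_ ≡? _ [mod q ]) (¬? (+ p ∣? _)) pos
        (al' , _)    = 𝟙*𝟙-pos (_ ≡? _ [mod q ]) (¬? (+ p ∣? _)) pos'
    in slope-unique a b a' b' t<q t'<q unit al al'

  aligned-fibre : ∀ t a b a' → ∑[ b' < q ] aligned t a b a' b' ≤ 1
  aligned-fibre t a b a' = ∑-≤1 q _ (λ b' → 𝟙≤1 (_ ≡? _ [mod q ])) λ b' b'' b'<q b''<q pos pos' →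
    residue-unique b'<q b''<q (mod-by (cancel (+ b') (+ b'') (+ t *ℤ + a'))
      (mod-trans (mod-sym (𝟙-pos (_ ≡? _ [mod q ]) pos)) (𝟙-pos (_ ≡? _ [mod q ]) pos')))
    where
    cancel : ∀ b' b'' x → (b' -ℤ x) -ℤ (b'' -ℤ x) ≡ b' -ℤ b''
    cancel = ℤ-Ring.solve-∀

  nonunit-steps : 1 ≤ l → ∀ a → p * ∑[ a' < q ] nonunit-step a a' ≤ q
  nonunit-steps l≥1 a = subst (λ m → p * ∑[ a' < m ] nonunit-step a a' ≤ m) (sym (split-power l l≥1))
                             (*-monoʳ-≤ p (multiples-in-range p (p ^ (l ∸ 1)) (ℤ.- (+ a))))
    where
    split-power : ∀ l → 1 ≤ l → p ^ l ≡ p * p ^ (l ∸ 1)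
    split-power (suc l) _ = refl

  -- Over all directions t, at most q · #{a' | p ∣ a' - a} points (a', b') are aligned with (a, b)
  -- through a non-unit step: one b' per direction and abscissa.
  nonunit-aligned-points : ∀ a b →
    ∑²[ a' , b' < q ] ∑[ t < q ] (aligned t a b a' b' * nonunit-step a a') ≤ q * ∑[ a' < q ] nonunit-step a a'
  nonunit-aligned-points a b = begin
    ∑[ a' < q ] ∑[ b' < q ] ∑[ t < q ] Z t a' b'              ≡⟨ ∑-cong q (λ a' _ → ∑-comm q q (λ b' t → Z t a' b')) ⟩
    ∑[ a' < q ] ∑[ t < q ] ∑[ b' < q ] Z t a' b'              ≡⟨ ∑-cong q (λ a' _ → ∑-cong q (λ t _ → sym (∑-distribʳ q _ _))) ⟩
    ∑[ a' < q ] ∑[ t < q ] (∑[ b' < q ] aligned t a b a' b' * nonunit-step a a')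
      ≤⟨ ∑-mono q (λ a' _ → ∑-mono q (λ t _ → *-monoˡ-≤ (nonunit-step a a') (aligned-fibre t a b a'))) ⟩
    ∑[ a' < q ] ∑[ t < q ] (1 * nonunit-step a a')            ≡⟨ ∑-cong q (λ a' _ → ∑-const q _) ⟩
    ∑[ a' < q ] (q * (1 * nonunit-step a a'))                 ≡⟨ ∑-cong q (λ a' _ → cong (q *_) (*-identityˡ _)) ⟩
    ∑[ a' < q ] (q * nonunit-step a a')                       ≡⟨ sym (∑-distribˡ q q _) ⟩
    q * ∑[ a' < q ] nonunit-step a a'                         ∎
    where
    open ≤-Reasoning
    Z : ℕ → ℕ → ℕ → ℕ
    Z t a' b' = aligned t a b a' b' * nonunit-step a a'

  module PointSet (E : List (Point q)) where

    open Incidences E public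

    unit-pairs nonunit-pairs : ℕ → ℕ
    unit-pairs    t = aligned-pairs t unit-step
    nonunit-pairs t = aligned-pairs t nonunit-step

    incidence-bound-split : ∀ t → length E * length E ≤ lines-meeting t * (unit-pairs t + nonunit-pairs t)
    incidence-bound-split t = subst (λ n → length E * length E ≤ lines-meeting t * n)
      (aligned-pairs-split t unit-step nonunit-step steps-complementary) (incidence-bound t)

    -- Each pair with a unit step is aligned in at most one direction.
    ∑unit-pairs≤|E|² : ∑ q unit-pairs ≤ length E * length E
    ∑unit-pairs≤|E|² = begin
      ∑[ t < q ] ∑²[ a , b < q ] ∑²[ a' , b' < q ] F t a b a' b'
        ≡⟨ ∑-∑²-comm q q (λ t a b → ∑²[ a' , b' < q ] F t a b a' b') ⟩
      ∑²[ a , b < q ] ∑[ t < q ] ∑²[ a' , b' < q ] F t a b a' b'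
        ≡⟨ ∑²-cong q (λ a b → ∑-∑²-comm q q (λ t a' b' → F t a b a' b')) ⟩
      ∑²[ a , b < q ] ∑²[ a' , b' < q ] ∑[ t < q ] F t a b a' b'
        ≤⟨ ∑²-mono q (λ a b → ∑²-mono q (λ a' b' → pair a b a' b')) ⟩
      ∑²[ a , b < q ] ∑²[ a' , b' < q ] (mult E a b * mult E a' b')
        ≡⟨ sym (∑²-product q (mult E) (mult E)) ⟩
      ∑² q (mult E) * ∑² q (mult E)
        ≡⟨ cong₂ _*_ (∑²-mult E) (∑²-mult E) ⟩
      length E * length E
        ∎
      where
      open ≤-Reasoning
      F : ℕ → ℕ → ℕ → ℕ → ℕ → ℕ
      F t a b a' b' = mult E a b * mult E a' b' * (aligned t a b a' b' * unit-step a a')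
      pair : ∀ a b a' b' → ∑[ t < q ] F t a b a' b' ≤ mult E a b * mult E a' b'
      pair a b a' b' = begin
        ∑[ t < q ] F t a b a' b'                                                     ≡⟨ sym (∑-distribˡ q (mult E a b * mult E a' b') _) ⟩
        mult E a b * mult E a' b' * ∑[ t < q ] (aligned t a b a' b' * unit-step a a') ≤⟨ *-monoʳ-≤ (mult E a b * mult E a' b') (slopes-of-unit-step a b a' b') ⟩
        mult E a b * mult E a' b' * 1                                                ≡⟨ *-identityʳ _ ⟩
        mult E a b * mult E a' b'                                                    ∎

    -- Pairs with a non-unit step: since E has no repetitions, a point (a, b) of E has at most
    -- q · q/p partners counted over all directions.
    pairs-from-point : Unique E → 1 ≤ l → ∀ a b →
      p * ∑²[ a' , b' < q ] ∑[ t < q ] (mult E a b * mult E a' b' * (aligned t a b a' b' * nonunit-step a a'))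
        ≤ mult E a b * (q * q)
    pairs-from-point uniq l≥1 a b = begin
      p * ∑²[ a' , b' < q ] ∑[ t < q ] (χ * mult E a' b' * Z t a' b')
        ≤⟨ *-monoʳ-≤ p (∑²-mono q (λ a' b' → ∑-mono q (λ t _ → *-monoˡ-≤ (Z t a' b') at-most-once))) ⟩
      p * ∑²[ a' , b' < q ] ∑[ t < q ] (χ * 1 * Z t a' b')
        ≡⟨ cong (p *_) (∑²-cong q (λ a' b' → sym (∑-distribˡ q (χ * 1) (λ t → Z t a' b')))) ⟩
      p * ∑²[ a' , b' < q ] (χ * 1 * ∑[ t < q ] Z t a' b')
        ≡⟨ cong (p *_) (sym (∑²-distribˡ q (χ * 1) _)) ⟩
      p * (χ * 1 * ∑²[ a' , b' < q ] ∑[ t < q ] Z t a' b')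
        ≤⟨ *-monoʳ-≤ p (*-monoʳ-≤ (χ * 1) (nonunit-aligned-points a b)) ⟩
      p * (χ * 1 * (q * ∑[ a' < q ] nonunit-step a a'))
        ≡⟨ regroup p χ q (∑[ a' < q ] nonunit-step a a') ⟩
      χ * (q * (p * ∑[ a' < q ] nonunit-step a a'))
        ≤⟨ *-monoʳ-≤ χ (*-monoʳ-≤ q (nonunit-steps l≥1 a)) ⟩
      χ * (q * q)
        ∎
      where
      open ≤-Reasoning
      χ : ℕ
      χ = mult E a b
      Z : ℕ → ℕ → ℕ → ℕ
      Z t a' b' = aligned t a b a' b' * nonunit-step a a'
      at-most-once : ∀ {a' b'} → χ * mult E a' b' ≤ χ * 1
      at-most-once {a'} {b'} = *-monoʳ-≤ χ (mult≤1 E uniq a' b')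
      regroup : ∀ p x q s → p * (x * 1 * (q * s)) ≡ x * (q * (p * s))
      regroup = ℕ-Ring.solve-∀

    p∑nonunit-pairs≤|E|q² : Unique E → 1 ≤ l → p * ∑ q nonunit-pairs ≤ length E * (q * q)
    p∑nonunit-pairs≤|E|q² uniq l≥1 = begin
      p * ∑[ t < q ] ∑²[ a , b < q ] ∑²[ a' , b' < q ] F t a b a' b'
        ≡⟨ cong (p *_) (∑-∑²-comm q q (λ t a b → ∑²[ a' , b' < q ] F t a b a' b')) ⟩
      p * ∑²[ a , b < q ] ∑[ t < q ] ∑²[ a' , b' < q ] F t a b a' b'
        ≡⟨ cong (p *_) (∑²-cong q (λ a b → ∑-∑²-comm q q (λ t a' b' → F t a b a' b'))) ⟩
      p * ∑²[ a , b < q ] ∑²[ a' , b' < q ] ∑[ t < q ] F t a b a' b'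
        ≡⟨ ∑²-distribˡ q p _ ⟩
      ∑²[ a , b < q ] (p * ∑²[ a' , b' < q ] ∑[ t < q ] F t a b a' b')
        ≤⟨ ∑²-mono q (pairs-from-point uniq l≥1) ⟩
      ∑²[ a , b < q ] (mult E a b * (q * q))
        ≡⟨ sym (∑²-distribʳ q (q * q) (mult E)) ⟩
      ∑² q (mult E) * (q * q)
        ≡⟨ cong (_* (q * q)) (∑²-mult E) ⟩
      length E * (q * q)
        ∎
      where
      open ≤-Reasoning
      F : ℕ → ℕ → ℕ → ℕ → ℕ → ℕ
      F t a b a' b' = mult E a b * mult E a' b' * (aligned t a b a' b' * nonunit-step a a')

    record UnitPair (t : ℕ) : Set where
      field
        u₁ v₁ u₃ v₃ : Fin q
        x₁∈E        : (u₁ , v₁) ∈ E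
        x₃∈E        : (u₃ , v₃) ∈ E
        x₃-x₁       : Aligned t (toℕ u₃) (toℕ v₃) (toℕ u₁) (toℕ v₁)
        unit        : ¬ (+ p ∣ (⟦ u₁ ⟧ -ℤ ⟦ u₃ ⟧))

    unit-pair : ∀ t → 0 < unit-pairs t → UnitPair t
    unit-pair t pos with ∑²-pos q _ pos
    ... | a , b , pos-ab with ∑²-pos q _ pos-ab
    ... | a' , b' , pos-pair with *-pos (mult E a b * mult E a' b') _ pos-pair
    ... | pos-mult , pos-weight with *-pos (mult E a b) (mult E a' b') pos-mult
    ... | pos-x₃ , pos-x₁ with mult-pos E a b pos-x₃ | mult-pos E a' b' pos-x₁
    ... | (u₃ , v₃) , x₃∈E , refl , refl | (u₁ , v₁) , x₁∈E , refl , refl =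
      record { x₁∈E = x₁∈E ; x₃∈E = x₃∈E ; x₃-x₁ = proj₁ aligned-unit ; unit = proj₂ aligned-unit }
      where
      aligned-unit = 𝟙*𝟙-pos (_ ≡? _ [mod q ]) (¬? (+ p ∣? _)) pos-weight

    -- Given such a pair, the determinants det(x₁ - x₃, x₂ - x₃) with x₂ running over E
    -- take a different value on each line of slope t.
    module Determinants {t : ℕ} (pair : UnitPair t) where

      open UnitPair pair

      δ I₃ : ℤ
      δ  = ⟦ u₁ ⟧ -ℤ ⟦ u₃ ⟧
      I₃ = intercept t (toℕ u₃) (toℕ v₃)

      det-of-line : ℕ → ℕ
      det-of-line c = (δ *ℤ (+ c -ℤ I₃)) %ℕ q

      det-of-line<q : ∀ c → det-of-line c < q
      det-of-line<q c = n%ℕd<d (δ *ℤ (+ c -ℤ I₃)) q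

      determinant-on-line : ∀ {c} u₂ v₂ → OnLine t c (toℕ u₂) (toℕ v₂) →
                            detℤ (u₁ , v₁) (u₂ , v₂) (u₃ , v₃) ≡ δ *ℤ (+ c -ℤ I₃) [mod q ]
      determinant-on-line u₂ v₂ on-c = mod-trans
        (mod-by (expand ⟦ u₁ ⟧ ⟦ v₁ ⟧ ⟦ u₂ ⟧ ⟦ v₂ ⟧ ⟦ u₃ ⟧ ⟦ v₃ ⟧ (+ t)) (mod-*ˡ (⟦ u₂ ⟧ -ℤ ⟦ u₃ ⟧) x₃-x₁))
        (mod-*ˡ δ (mod-by (shift (intercept t (toℕ u₂) (toℕ v₂)) _ I₃) on-c))
        where
        expand : ∀ a₁ b₁ a₂ b₂ a₃ b₃ t →
          (a₂ -ℤ a₃) *ℤ (b₃ -ℤ t *ℤ a₃) -ℤ (a₂ -ℤ a₃) *ℤ (b₁ -ℤ t *ℤ a₁)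
            ≡ ((a₁ -ℤ a₃) *ℤ (b₂ -ℤ b₃) -ℤ (a₂ -ℤ a₃) *ℤ (b₁ -ℤ b₃)) -ℤ (a₁ -ℤ a₃) *ℤ ((b₂ -ℤ t *ℤ a₂) -ℤ (b₃ -ℤ t *ℤ a₃))
        expand = ℤ-Ring.solve-∀
        shift : ∀ x c i → x -ℤ c ≡ (x -ℤ i) -ℤ (c -ℤ i)
        shift = ℤ-Ring.solve-∀

      -- Since δ is a unit, distinct lines give distinct determinants.
      det-of-line-injective : ∀ c c' → c < q → c' < q → det-of-line c ≡ det-of-line c' → c ≡ c'
      det-of-line-injective c c' c<q c'<q same =
        residue-unique c<q c'<q (mod-by (cancel (+ c) (+ c') I₃)
          (unit-cancel l pr unit (%ℕ-equal⇒mod (δ *ℤ (+ c -ℤ I₃)) (δ *ℤ (+ c' -ℤ I₃)) q same)))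
        where
        cancel : ∀ c c' i → (c -ℤ i) -ℤ (c' -ℤ i) ≡ c -ℤ c'
        cancel = ℤ-Ring.solve-∀

      line-determinant∈V₂ : ∀ c → 0 < points-on t c → det-of-line c ≢ 0 →
                            InV2 q E (fromℕ< (det-of-line<q c))
      line-determinant∈V₂ c meets nonzero with ∑²-pos q _ meets
      ... | a₂ , b₂ , pos with *-pos (mult E a₂ b₂) _ pos
      ... | pos-x₂ , pos-on with mult-pos E a₂ b₂ pos-x₂
      ... | (u₂ , v₂) , x₂∈E , refl , refl =
        nonzero ∘ trans (sym (toℕ-fromℕ< (det-of-line<q c))) ,
        (u₁ , v₁) , (u₂ , v₂) , (u₃ , v₃) , x₁∈E , x₂∈E , x₃∈E ,
        ∣⇒∣ᵤ (_≡_[mod_].difference (subst (λ r → detℤ (u₁ , v₁) (u₂ , v₂) (u₃ , v₃) ≡ + r [mod q ])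
               (sym (toℕ-fromℕ< (det-of-line<q c)))
               (mod-trans (determinant-on-line u₂ v₂ (𝟙-pos (_ ≡? _ [mod q ]) pos-on)) (mod-reduce _ q))))

      lines-meeting≤|V₂|+1 : (V : List (Fin q)) → (∀ d → d ∈ V ⇔ InV2 q E d) → lines-meeting t ≤ 1 + length V
      lines-meeting≤|V₂|+1 V V≡V₂ = begin
        ∑[ c < q ] 𝟙 (0 <? points-on t c)
          ≤⟨ ∑-mono q (λ c _ → 𝟙-split (0 <? points-on t c) (det-of-line c ≟ 0)) ⟩
        ∑[ c < q ] (𝟙 (det-of-line c ≟ 0) + 𝟙 (Counted? c))
          ≡⟨ ∑-distrib-+ q _ _ ⟩
        ∑[ c < q ] 𝟙 (det-of-line c ≟ 0) + ∑[ c < q ] 𝟙 (Counted? c)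
          ≤⟨ +-mono-≤ at-most-one-zero (count-by-injection q q Counted? det-of-line (occ V)
                (λ c _ _ → det-of-line<q c) (λ c c' c<q c'<q _ _ → det-of-line-injective c c' c<q c'<q)
                (λ c _ (meets , nonzero) → subst (λ d → 1 ≤ occ V d) (toℕ-fromℕ< (det-of-line<q c))
                   (occ-∈ V _ (Equivalence.from (V≡V₂ _) (line-determinant∈V₂ c meets nonzero))))) ⟩
        1 + ∑ q (occ V)
          ≡⟨ cong suc (∑-occ V) ⟩
        1 + length V
          ∎
        where
        open ≤-Reasoning
        Counted? : ∀ c → Dec (0 < points-on t c × ¬ det-of-line c ≡ 0)
        Counted? c = (0 <? points-on t c) ×-dec ¬? (det-of-line c ≟ 0)
        at-most-one-zero : ∑[ c < q ] 𝟙 (det-of-line c ≟ 0) ≤ 1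
        at-most-one-zero = ∑-≤1 q _ (λ c → 𝟙≤1 (det-of-line c ≟ 0)) λ c c' c<q c'<q zero-c zero-c' →
          det-of-line-injective c c' c<q c'<q (trans (𝟙-pos (_ ≟ 0) zero-c) (sym (𝟙-pos (_ ≟ 0) zero-c')))

    Rich : ℕ → Set
    Rich t = 0 < unit-pairs t × q * (1 + p) ≤ 4 * p * lines-meeting t

    -- When |E|² > q⁴ / p some direction is rich: otherwise averaging the incidence bound over
    -- all directions contradicts the size of E.
    rich-direction : Unique E → 1 ≤ l → 3 ≤ p → q * q * q * q < p * (length E * length E) → ∃ Rich
    rich-direction uniq l≥1 p≥3 many with anyUpTo? (λ t → (0 <? unit-pairs t) ×-dec (q * (1 + p) ≤? 4 * p * lines-meeting t)) q
    ... | yes (t , _ , rich) = t , rich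
    ... | no  none = ⊥-elim (few-points p q (length E) p≥3 many
      (averaged-bound p q (length E) unit-pairs nonunit-pairs poor-direction ∑unit-pairs≤|E|² (p∑nonunit-pairs≤|E|q² uniq l≥1)))
      where
      poor-direction : ∀ t → t < q → 4 * p * (length E * length E) ≤ 4 * p * q * nonunit-pairs t + q * (1 + p) * unit-pairs t
      poor-direction t t<q = direction-bound p q (length E) (lines-meeting t) (unit-pairs t) (nonunit-pairs t)
        (≤-trans (s≤s z≤n) p≥3) (∑-≤-length q _ (λ c → 𝟙≤1 (0 <? points-on t c))) (incidence-bound-split t)
        (λ rich → none (t , t<q , rich))

odd-prime≥3 : ∀ {p} → Prime p → p % 2 ≡ 1 → 3 ≤ p
odd-prime≥3 {suc (suc (suc _))} _ _ = s≤s (s≤s (s≤s z≤n))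
odd-prime≥3 {suc zero} pr _ = ⊥-elim (nonTrivial⇒≢1 {{prime⇒nonTrivial pr}} refl)

-- The hypothesis |E|² > p^(4l - 1) reads  q⁴ < p |E|².
q⁴≡p·p^[4l-1] : ∀ p l → 1 ≤ l → p ^ l * p ^ l * p ^ l * p ^ l ≡ p * p ^ (4 * l ∸ 1)
q⁴≡p·p^[4l-1] p (suc l) _ = trans (fourth-power (p ^ suc l)) (trans (^-*-assoc p (suc l) 4) (cong (p ^_) (*-comm (suc l) 4)))
  where
  fourth-power : ∀ x → x * x * x * x ≡ x * (x * (x * (x * 1)))
  fourth-power = ℕ-Ring.solve-∀

theorem1p2 : (p l : ℕ) → Prime p → p % 2 ≡ 1 → 1 ≤ l →
    (E : List (Point (p ^ l))) → Unique E →
    p ^ (4 * l ∸ 1) < length E * length E →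
    (V : List (Fin (p ^ l))) → Unique V →
    (∀ d → d ∈ V ⇔ InV2 (p ^ l) E d) →
    p ^ l * (1 + p) ≤ 4 * p * (length V + 1)
theorem1p2 p l pr odd l≥1 E uniq many V _ V≡V₂ = ≤-trans enough-lines (*-monoʳ-≤ (4 * p) lines≤|V|+1)
  where
  open PrimePower p l pr
  open PointSet E
  q⁴<p|E|² : q * q * q * q < p * (length E * length E)
  q⁴<p|E|² = subst (_< p * (length E * length E)) (sym (q⁴≡p·p^[4l-1] p l l≥1)) (*-monoʳ-< p {{prime⇒nonZero pr}} many)
  rich : ∃ Rich
  rich = rich-direction uniq l≥1 (odd-prime≥3 pr odd) q⁴<p|E|²
  t : ℕ
  t = proj₁ rich
  enough-lines : q * (1 + p) ≤ 4 * p * lines-meeting t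
  enough-lines = proj₂ (proj₂ rich)
  lines≤|V|+1 : lines-meeting t ≤ length V + 1
  lines≤|V|+1 = subst (lines-meeting t ≤_) (+-comm 1 (length V))
                  (Determinants.lines-meeting≤|V₂|+1 (unit-pair t (proj₁ (proj₂ rich))) V V≡V₂)
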